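{- Let $k$ be a positive integer and $U_1,N_1,U_2,N_2,Y$ positive integers. Let $J_k(U_1,N_1,U_2,N_2,Y)$ denote the number of integer quadruples $(u_1,n_1,u_2,n_2)$ with $$U_1\leqslant u_1<2U_1,\quad N_1\leqslant n_1<2N_1,\quad U_2\leqslant u_2<2U_2,\quad N_2\leqslant n_2<2N_2,$$ satisfying $$\left|\frac{u_1}{n_1^k}-\frac{u_2}{n_2^k}\right|\leqslant\frac{1}{Y},$$ and write $J_k(U,N,Y)=J_k(U,N,U,N,Y)$. Then $$J_k(U_1,N_1,U_2,N_2,Y)\ll J_k(U_1,N_1,Y)^{1/2}J_k(U_2,N_2,Y)^{1/2}.$$
   Context: $A\ll B$ means $|A|\leqslant cB$ for an absolute constant $c$. -}

module Defs where

open import Data.Nat as ℕ using (ℕ; zero; suc; _+_; _*_; _^_)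
open import Data.Nat.Properties using (m^n≢0)
open import Data.Integer using (+_)
open import Data.Rational as ℚ using (ℚ; _/_; 0ℚ; ∣_∣; _≤?_; _-_)
open import Data.List using (List; length; filter; upTo; map; concatMap)
open import Data.Product using (_×_; _,_)

-- u / n^k as a rational number (the n = 0 branch is never used, since n ≥ N ≥ 1)
frac : ℕ → ℕ → ℕ → ℚ
frac u zero    k = 0ℚ
frac u (suc m) k = _/_ (+ u) (suc m ^ k) {{m^n≢0 (suc m) k}}

-- 1 / Y as a rational (Y = 0 branch never used, since Y ≥ 1)
inv : ℕ → ℚ
inv zero    = 0ℚ
inv (suc m) = (+ 1) / suc m

dyadic : ℕ → List ℕ
dyadic A = map (λ i → A + i) (upTo A)

Quad : Set
Quad = ℕ × ℕ × ℕ × ℕ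

quads : ℕ → ℕ → ℕ → ℕ → List Quad
quads U₁ N₁ U₂ N₂ =
  concatMap (λ u₁ → concatMap (λ n₁ → concatMap (λ u₂ → map (λ n₂ → (u₁ , n₁ , u₂ , n₂))
    (dyadic N₂)) (dyadic U₂)) (dyadic N₁)) (dyadic U₁)

J : ℕ → ℕ → ℕ → ℕ → ℕ → ℕ → ℕ
J k U₁ N₁ U₂ N₂ Y =
  length (filter (λ { (u₁ , n₁ , u₂ , n₂) → ∣ frac u₁ n₁ k - frac u₂ n₂ k ∣ ≤? inv Y })
                 (quads U₁ N₁ U₂ N₂))

J′ : ℕ → ℕ → ℕ → ℕ → ℕ
J′ k U N Y = J k U N U N Y

{-# OPTIONS --safe #-}

-- Put u / n^k into the bin ⌊ Y u / n^k ⌋. Two fractions within 1/Y of each other lie in the same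
-- or in neighbouring bins, and two fractions in the same bin are within 1/Y of each other.
-- Hence J ≤ X₀ + X₁ + X₂, where X₀, X₁, X₂ count the pairs whose bins differ by d = 0, +1, −1.
-- Such a count is ∑ᵢ r₁(i) r₂(i − d) for the bin populations rₗ, so by Cauchy–Schwarz it is at
-- most ((∑ r₁²)(∑ r₂²))^½, and ∑ rₗ² counts pairs in a common bin, which is at most J_k(Uₗ,Nₗ,Y).
-- Altogether J² ≤ (X₀ + X₁ + X₂)² ≤ 9 J_k(U₁,N₁,Y) J_k(U₂,N₂,Y).

module Submission where

open import Defs
open import Data.Nat
open import Data.Nat.Properties
open import Data.Nat.DivMod using (_/_; _%_; m≡m%n+[m/n]*n; m%n<n; m/n*n≤m; m<n*o⇒m/o<n)
open import Data.Nat.Tactic.RingSolver using (solve-∀)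
open import Data.Bool using (true; false; if_then_else_)
open import Data.List using (List; []; _∷_; _++_; map; concatMap; filter; length; downFrom)
open import Data.List.Relation.Unary.All as All using (All; []; _∷_)
open import Data.List.Relation.Unary.All.Properties using (map⁺; concat⁺)
open import Data.Product using (Σ; _×_; _,_; proj₂)
open import Data.Sum using (inj₁; inj₂)
open import Function using (_∘_)
open import Function.Bundles using (_⇔_; mk⇔; Equivalence)
open import Relation.Binary.PropositionalEquality hiding (J)
open import Relation.Binary.Definitions using (tri<; tri≈; tri>)
open import Relation.Nullary using (Dec; does; yes; no; ¬_)
open import Relation.Nullary.Decidable using (dec-true; dec-false)
open import Relation.Unary using (Decidable)
import Data.Integer as ℤ
import Data.Integer.Properties as ℤ
import Data.Rational as ℚ
import Data.Rational.Properties as ℚ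
open import Data.Rational.Unnormalised as ℚᵘ using (ℚᵘ; mkℚᵘ; ↥_; ↧_; *≤*)
import Data.Rational.Unnormalised.Properties as ℚᵘ

private variable
  A B : Set
  P Q : Set

𝟙 : Dec P → ℕ
𝟙 P? = if does P? then 1 else 0

𝟙≡1 : (P? : Dec P) → P → 𝟙 P? ≡ 1
𝟙≡1 P? p rewrite dec-true P? p = refl

𝟙≡0 : (P? : Dec P) → ¬ P → 𝟙 P? ≡ 0
𝟙≡0 P? ¬p rewrite dec-false P? ¬p = refl

𝟙-≤ : ∀ {n} (P? : Dec P) → (P → 1 ≤ n) → 𝟙 P? ≤ n
𝟙-≤ P? P⇒1≤n with P?
... | yes p = P⇒1≤n p
... | no _  = z≤n

𝟙-mono : (P? : Dec P) (Q? : Dec Q) → (P → Q) → 𝟙 P? ≤ 𝟙 Q?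
𝟙-mono P? Q? P⇒Q = 𝟙-≤ P? (λ p → ≤-reflexive (sym (𝟙≡1 Q? (P⇒Q p))))

δ : ℕ → ℕ → ℕ
δ m n = 𝟙 (m ≟ n)

δ-sym : ∀ m n → δ m n ≡ δ n m
δ-sym m n = ≤-antisym (𝟙-mono (m ≟ n) (n ≟ m) sym) (𝟙-mono (n ≟ m) (m ≟ n) sym)

δ-adjacent : ∀ {a b} → a ≤ suc b → b ≤ suc a → 1 ≤ δ a b + δ a (suc b) + δ (suc a) b
δ-adjacent {a} {b} a≤1+b b≤1+a with <-cmp a b
... | tri< a<b _ _ = ≤-trans (≤-reflexive (sym (𝟙≡1 (suc a ≟ b) (≤-antisym a<b b≤1+a))))
                             (m≤n+m _ (δ a b + δ a (suc b)))
... | tri≈ _ a≡b _ = ≤-trans (≤-reflexive (sym (𝟙≡1 (a ≟ b) a≡b)))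
                             (≤-trans (m≤m+n _ (δ a (suc b))) (m≤m+n _ (δ (suc a) b)))
... | tri> _ _ b<a = ≤-trans (≤-reflexive (sym (𝟙≡1 (a ≟ suc b) (≤-antisym a≤1+b b<a))))
                             (≤-trans (m≤n+m _ (δ a b)) (m≤m+n _ (δ (suc a) b)))

∑ : List A → (A → ℕ) → ℕ
∑ []       f = 0
∑ (x ∷ xs) f = f x + ∑ xs f

infix 5 ∑
syntax ∑ xs (λ x → e) = ∑[ x ∈ xs ] e

module _ {A : Set} where

  ∑-cong : ∀ xs {f g : A → ℕ} → (∀ x → f x ≡ g x) → ∑ xs f ≡ ∑ xs g
  ∑-cong []       f≡g = refl
  ∑-cong (x ∷ xs) f≡g = cong₂ _+_ (f≡g x) (∑-cong xs f≡g)

  ∑-cong-on : ∀ {xs} {f g : A → ℕ} → All (λ x → f x ≡ g x) xs → ∑ xs f ≡ ∑ xs g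
  ∑-cong-on []           = refl
  ∑-cong-on (fx≡gx ∷ hs) = cong₂ _+_ fx≡gx (∑-cong-on hs)

  ∑-mono : ∀ xs {f g : A → ℕ} → (∀ x → f x ≤ g x) → ∑ xs f ≤ ∑ xs g
  ∑-mono []       f≤g = z≤n
  ∑-mono (x ∷ xs) f≤g = +-mono-≤ (f≤g x) (∑-mono xs f≤g)

  ∑-mono-on : ∀ {xs} {f g : A → ℕ} → All (λ x → f x ≤ g x) xs → ∑ xs f ≤ ∑ xs g
  ∑-mono-on []           = z≤n
  ∑-mono-on (fx≤gx ∷ hs) = +-mono-≤ fx≤gx (∑-mono-on hs)

  ∑-+ : ∀ xs (f g : A → ℕ) → ∑[ x ∈ xs ] (f x + g x) ≡ ∑ xs f + ∑ xs g
  ∑-+ []       f g = refl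
  ∑-+ (x ∷ xs) f g = trans (cong (f x + g x +_) (∑-+ xs f g)) (+-+-comm (f x) (g x) _ _)
    where
    +-+-comm : ∀ a b c d → a + b + (c + d) ≡ a + c + (b + d)
    +-+-comm = solve-∀

  ∑-*ˡ : ∀ xs c (f : A → ℕ) → ∑[ x ∈ xs ] c * f x ≡ c * ∑ xs f
  ∑-*ˡ []       c f = sym (*-zeroʳ c)
  ∑-*ˡ (x ∷ xs) c f = trans (cong (c * f x +_) (∑-*ˡ xs c f)) (sym (*-distribˡ-+ c (f x) _))

  ∑-*ʳ : ∀ xs c (f : A → ℕ) → ∑[ x ∈ xs ] f x * c ≡ ∑ xs f * c
  ∑-*ʳ xs c f = trans (∑-cong xs (λ x → *-comm (f x) c)) (trans (∑-*ˡ xs c f) (*-comm c _))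

  ∑-zero : ∀ (xs : List A) → ∑[ x ∈ xs ] 0 ≡ 0
  ∑-zero []       = refl
  ∑-zero (_ ∷ xs) = ∑-zero xs

  term≤∑ : ∀ xs (f : A → ℕ) → All (λ x → f x ≤ ∑ xs f) xs
  term≤∑ []       f = []
  term≤∑ (x ∷ xs) f = m≤m+n (f x) _ ∷ All.map (λ fy≤ → ≤-trans fy≤ (m≤n+m _ (f x))) (term≤∑ xs f)

  ∑-++ : ∀ xs ys (f : A → ℕ) → ∑ (xs ++ ys) f ≡ ∑ xs f + ∑ ys f
  ∑-++ []       ys f = refl
  ∑-++ (x ∷ xs) ys f = trans (cong (f x +_) (∑-++ xs ys f)) (sym (+-assoc (f x) _ _))

  ∑-map : ∀ (h : B → A) xs (f : A → ℕ) → ∑ (map h xs) f ≡ ∑[ x ∈ xs ] f (h x)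
  ∑-map h []       f = refl
  ∑-map h (x ∷ xs) f = cong (f (h x) +_) (∑-map h xs f)

  ∑-concatMap : ∀ (h : B → List A) xs (f : A → ℕ) → ∑ (concatMap h xs) f ≡ ∑[ x ∈ xs ] ∑ (h x) f
  ∑-concatMap h []       f = refl
  ∑-concatMap h (x ∷ xs) f = trans (∑-++ (h x) (concatMap h xs) f) (cong (∑ (h x) f +_) (∑-concatMap h xs f))

  length-filter≡∑𝟙 : ∀ {P : A → Set} (P? : Decidable P) xs → length (filter P? xs) ≡ ∑[ x ∈ xs ] 𝟙 (P? x)
  length-filter≡∑𝟙 P? []       = refl
  length-filter≡∑𝟙 P? (x ∷ xs) with does (P? x)
  ... | true  = cong suc (length-filter≡∑𝟙 P? xs)
  ... | false = length-filter≡∑𝟙 P? xs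

∑-swap : ∀ (xs : List A) (ys : List B) (h : A → B → ℕ) →
         ∑[ x ∈ xs ] ∑[ y ∈ ys ] h x y ≡ ∑[ y ∈ ys ] ∑[ x ∈ xs ] h x y
∑-swap []       ys h = sym (∑-zero ys)
∑-swap (x ∷ xs) ys h = trans (cong (∑ ys (h x) +_) (∑-swap xs ys h)) (sym (∑-+ ys (h x) _))

∑-*-∑ : ∀ (xs : List A) (ys : List B) f g → ∑ xs f * ∑ ys g ≡ ∑[ x ∈ xs ] ∑[ y ∈ ys ] f x * g y
∑-*-∑ xs ys f g = trans (sym (∑-*ʳ xs (∑ ys g) f)) (∑-cong xs (λ x → sym (∑-*ˡ ys (f x) g)))

∑∑-+ : ∀ (xs : List A) (ys : List B) (f g : A → B → ℕ) →
       ∑[ x ∈ xs ] ∑[ y ∈ ys ] (f x y + g x y)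
         ≡ (∑[ x ∈ xs ] ∑[ y ∈ ys ] f x y) + (∑[ x ∈ xs ] ∑[ y ∈ ys ] g x y)
∑∑-+ xs ys f g = trans (∑-cong xs (λ x → ∑-+ ys (f x) (g x))) (∑-+ xs _ _)

∑∑-*ˡ : ∀ (xs : List A) (ys : List B) c (h : A → B → ℕ) →
        ∑[ x ∈ xs ] ∑[ y ∈ ys ] c * h x y ≡ c * (∑[ x ∈ xs ] ∑[ y ∈ ys ] h x y)
∑∑-*ˡ xs ys c h = trans (∑-cong xs (λ x → ∑-*ˡ ys c (h x))) (∑-*ˡ xs c _)

∑∑-mono-on : ∀ {xs : List A} {ys : List B} {Pˣ : A → Set} {Pʸ : B → Set} {f g : A → B → ℕ} →
             All Pˣ xs → All Pʸ ys → (∀ {x y} → Pˣ x → Pʸ y → f x y ≤ g x y) →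
             ∑[ x ∈ xs ] ∑[ y ∈ ys ] f x y ≤ ∑[ x ∈ xs ] ∑[ y ∈ ys ] g x y
∑∑-mono-on Pxs Pys f≤g = ∑-mono-on (All.map (λ Px → ∑-mono-on (All.map (f≤g Px) Pys)) Pxs)

-- Cauchy–Schwarz

≤⇒2*[m*n]≤m*m+n*n : ∀ {m n} → m ≤ n → 2 * (m * n) ≤ m * m + n * n
≤⇒2*[m*n]≤m*m+n*n {m} {n} m≤n = subst (λ k → 2 * (m * k) ≤ m * m + k * k) (m+[n∸m]≡n m≤n)
  (subst (2 * (m * (m + d)) ≤_) (square-expansion m d) (m≤m+n _ (d * d)))
  where
  d = n ∸ m
  square-expansion : ∀ m d → 2 * (m * (m + d)) + d * d ≡ m * m + (m + d) * (m + d)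
  square-expansion = solve-∀

2*[m*n]≤m*m+n*n : ∀ m n → 2 * (m * n) ≤ m * m + n * n
2*[m*n]≤m*m+n*n m n with ≤-total m n
... | inj₁ m≤n = ≤⇒2*[m*n]≤m*m+n*n m≤n
... | inj₂ n≤m = subst₂ _≤_ (cong (2 *_) (*-comm n m)) (+-comm (n * n) (m * m)) (≤⇒2*[m*n]≤m*m+n*n n≤m)

cauchy-schwarz : ∀ (xs : List A) (a b : A → ℕ) →
  (∑[ x ∈ xs ] a x * b x) * (∑[ x ∈ xs ] a x * b x) ≤ (∑[ x ∈ xs ] a x * a x) * (∑[ x ∈ xs ] b x * b x)
cauchy-schwarz xs a b = *-cancelˡ-≤ 2 (begin
  2 * (Σab * Σab)
    ≡⟨ cong (2 *_) (∑-*-∑ xs xs (λ x → a x * b x) (λ y → a y * b y)) ⟩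
  2 * (∑[ x ∈ xs ] ∑[ y ∈ xs ] (a x * b x) * (a y * b y))
    ≡⟨ ∑∑-*ˡ xs xs 2 _ ⟨
  (∑[ x ∈ xs ] ∑[ y ∈ xs ] 2 * ((a x * b x) * (a y * b y)))
    ≤⟨ ∑-mono xs (λ x → ∑-mono xs (λ y → amgm x y)) ⟩
  (∑[ x ∈ xs ] ∑[ y ∈ xs ] ((a x * a x) * (b y * b y) + (a y * a y) * (b x * b x)))
    ≡⟨ ∑∑-+ xs xs _ _ ⟩
  (∑[ x ∈ xs ] ∑[ y ∈ xs ] (a x * a x) * (b y * b y)) + (∑[ x ∈ xs ] ∑[ y ∈ xs ] (a y * a y) * (b x * b x))
    ≡⟨ cong₂ _+_ (∑-*-∑ xs xs _ _) (trans (∑-*-∑ xs xs _ _) (∑-swap xs xs _)) ⟨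
  Σa² * Σb² + Σa² * Σb²
    ≡⟨ cong (Σa² * Σb² +_) (+-identityʳ (Σa² * Σb²)) ⟨
  2 * (Σa² * Σb²) ∎)
  where
  open ≤-Reasoning
  Σab = ∑[ x ∈ xs ] a x * b x
  Σa² = ∑[ x ∈ xs ] a x * a x
  Σb² = ∑[ x ∈ xs ] b x * b x
  -- AM–GM for a x * b y and a y * b x
  amgm : ∀ x y → 2 * ((a x * b x) * (a y * b y)) ≤ (a x * a x) * (b y * b y) + (a y * a y) * (b x * b x)
  amgm x y = subst₂ _≤_ (lhs (a x) (b x) (a y) (b y)) (rhs (a x) (b x) (a y) (b y))
                        (2*[m*n]≤m*m+n*n (a x * b y) (a y * b x))
    where
    lhs : ∀ p q r s → 2 * ((p * s) * (r * q)) ≡ 2 * ((p * q) * (r * s))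
    lhs = solve-∀
    rhs : ∀ p q r s → (p * s) * (p * s) + (r * q) * (r * q) ≡ (p * p) * (s * s) + (r * r) * (q * q)
    rhs = solve-∀

[p+q+r]*[p+q+r]≤9*t : ∀ p q r {t} → p * p ≤ t → q * q ≤ t → r * r ≤ t → (p + q + r) * (p + q + r) ≤ 9 * t
[p+q+r]*[p+q+r]≤9*t p q r {t} p²≤t q²≤t r²≤t = begin
  (p + q + r) * (p + q + r)
    ≡⟨ expand p q r ⟩
  p * p + q * q + r * r + (2 * (p * q) + 2 * (q * r) + 2 * (p * r))
    ≤⟨ +-monoʳ-≤ (p * p + q * q + r * r)
         (+-mono-≤ (+-mono-≤ (2*[m*n]≤m*m+n*n p q) (2*[m*n]≤m*m+n*n q r)) (2*[m*n]≤m*m+n*n p r)) ⟩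
  p * p + q * q + r * r + ((p * p + q * q) + (q * q + r * r) + (p * p + r * r))
    ≡⟨ collect p q r ⟩
  3 * (p * p + q * q + r * r)
    ≤⟨ *-monoʳ-≤ 3 (+-mono-≤ (+-mono-≤ p²≤t q²≤t) r²≤t) ⟩
  3 * (t + t + t)
    ≡⟨ triple t ⟩
  9 * t ∎
  where
  open ≤-Reasoning
  expand : ∀ p q r → (p + q + r) * (p + q + r) ≡ p * p + q * q + r * r + (2 * (p * q) + 2 * (q * r) + 2 * (p * r))
  expand = solve-∀
  collect : ∀ p q r → p * p + q * q + r * r + ((p * p + q * q) + (q * q + r * r) + (p * p + r * r))
                      ≡ 3 * (p * p + q * q + r * r)
  collect = solve-∀
  triple : ∀ t → 3 * (t + t + t) ≡ 9 * t
  triple = solve-∀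

-- Coincidences of two labellings

fibre : List A → (A → ℕ) → ℕ → ℕ
fibre xs f i = ∑[ x ∈ xs ] δ (f x) i

coincidences : List A → List B → (A → ℕ) → (B → ℕ) → ℕ
coincidences xs ys f g = ∑[ x ∈ xs ] ∑[ y ∈ ys ] δ (f x) (g y)

∑-δ-vanish : ∀ M {m} (t : ℕ → ℕ) → M ≤ m → ∑[ i ∈ downFrom M ] δ m i * t i ≡ 0
∑-δ-vanish zero    t M≤m = refl
∑-δ-vanish (suc M) t M<m =
  cong₂ _+_ (cong (_* t M) (𝟙≡0 (_ ≟ M) (>⇒≢ M<m))) (∑-δ-vanish M t (<⇒≤ M<m))

∑-δ-sift : ∀ M {m} (t : ℕ → ℕ) → m < M → ∑[ i ∈ downFrom M ] δ m i * t i ≡ t m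
∑-δ-sift (suc M) {m} t m<1+M with m ≟ M
... | yes refl = trans (cong₂ _+_ (trans (cong (_* t m) (𝟙≡1 (m ≟ m) refl)) (*-identityˡ (t m)))
                                   (∑-δ-vanish M t ≤-refl))
                       (+-identityʳ (t m))
... | no m≢M   = cong₂ _+_ (cong (_* t M) (𝟙≡0 (m ≟ M) m≢M)) (∑-δ-sift M t (≤∧≢⇒< (s≤s⁻¹ m<1+M) m≢M))

coincidences≡∑fibre*fibre : ∀ M (xs : List A) (ys : List B) f g → All (λ x → f x < M) xs →
  coincidences xs ys f g ≡ ∑[ i ∈ downFrom M ] fibre xs f i * fibre ys g i
coincidences≡∑fibre*fibre M xs ys f g f<M = begin
  (∑[ x ∈ xs ] ∑[ y ∈ ys ] δ (f x) (g y))
    ≡⟨ ∑-cong-on (All.map (λ fx<M → ∑-cong ys (λ y → trans (δ-sym _ (g y)) (sym (∑-δ-sift M _ fx<M)))) f<M) ⟩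
  (∑[ x ∈ xs ] ∑[ y ∈ ys ] ∑[ i ∈ is ] δ (f x) i * δ (g y) i)
    ≡⟨ ∑-cong xs (λ x → ∑-swap ys is _) ⟩
  (∑[ x ∈ xs ] ∑[ i ∈ is ] ∑[ y ∈ ys ] δ (f x) i * δ (g y) i)
    ≡⟨ ∑-cong xs (λ x → ∑-cong is (λ i → ∑-*ˡ ys (δ (f x) i) (λ y → δ (g y) i))) ⟩
  (∑[ x ∈ xs ] ∑[ i ∈ is ] δ (f x) i * fibre ys g i)
    ≡⟨ ∑-swap xs is _ ⟩
  (∑[ i ∈ is ] ∑[ x ∈ xs ] δ (f x) i * fibre ys g i)
    ≡⟨ ∑-cong is (λ i → ∑-*ʳ xs (fibre ys g i) (λ x → δ (f x) i)) ⟩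
  (∑[ i ∈ is ] fibre xs f i * fibre ys g i) ∎
  where
  open ≡-Reasoning
  is = downFrom M

coincidences-cauchy-schwarz : ∀ (xs : List A) (ys : List B) f g →
  coincidences xs ys f g * coincidences xs ys f g ≤ coincidences xs xs f f * coincidences ys ys g g
coincidences-cauchy-schwarz xs ys f g = begin
  coincidences xs ys f g * coincidences xs ys f g
    ≡⟨ cong₂ _*_ (coincidences≡∑fibre*fibre M xs ys f g f<M) (coincidences≡∑fibre*fibre M xs ys f g f<M) ⟩
  (∑[ i ∈ is ] fibre xs f i * fibre ys g i) * (∑[ i ∈ is ] fibre xs f i * fibre ys g i)
    ≤⟨ cauchy-schwarz is (fibre xs f) (fibre ys g) ⟩
  (∑[ i ∈ is ] fibre xs f i * fibre xs f i) * (∑[ i ∈ is ] fibre ys g i * fibre ys g i)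
    ≡⟨ cong₂ _*_ (coincidences≡∑fibre*fibre M xs xs f f f<M) (coincidences≡∑fibre*fibre M ys ys g g g<M) ⟨
  coincidences xs xs f f * coincidences ys ys g g ∎
  where
  open ≤-Reasoning
  M = suc (∑ xs f + ∑ ys g)
  is = downFrom M
  f<M : All (λ x → f x < M) xs
  f<M = All.map (λ fx≤ → s≤s (≤-trans fx≤ (m≤m+n _ _))) (term≤∑ xs f)
  g<M : All (λ y → g y < M) ys
  g<M = All.map (λ gy≤ → s≤s (≤-trans gy≤ (m≤n+m _ _))) (term≤∑ ys g)

m<[1+m/n]*n : ∀ m n .{{_ : NonZero n}} → m < suc (m / n) * n
m<[1+m/n]*n m n = begin-strict
  m                 ≡⟨ m≡m%n+[m/n]*n m n ⟩
  m % n + m / n * n <⟨ +-monoˡ-< (m / n * n) (m%n<n m n) ⟩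
  n + m / n * n     ∎
  where open ≤-Reasoning

∣m*e-n*d∣≤d*e⇒m/d≤1+n/e : ∀ m d n e .{{_ : NonZero d}} .{{_ : NonZero e}} →
  ∣ m * e - n * d ∣ ≤ d * e → m / d ≤ suc (n / e)
∣m*e-n*d∣≤d*e⇒m/d≤1+n/e m d n e close = s≤s⁻¹ (m<n*o⇒m/o<n (*-cancelʳ-< e m _ (begin-strict
  m * e                          ≤⟨ m≤n+∣m-n∣ (m * e) (n * d) ⟩
  n * d + ∣ m * e - n * d ∣      ≤⟨ +-monoʳ-≤ (n * d) close ⟩
  n * d + d * e                  <⟨ +-monoˡ-< (d * e) (*-monoˡ-< d (m<[1+m/n]*n n e)) ⟩
  suc (n / e) * e * d + d * e    ≡⟨ regroup (n / e) d e ⟩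
  suc (suc (n / e)) * d * e      ∎)))
  where
  open ≤-Reasoning
  regroup : ∀ b d e → suc b * e * d + d * e ≡ suc (suc b) * d * e
  regroup = solve-∀

m/d≡n/e⇒m*e≤n*d+d*e : ∀ m d n e .{{_ : NonZero d}} .{{_ : NonZero e}} →
  m / d ≡ n / e → m * e ≤ n * d + d * e
m/d≡n/e⇒m*e≤n*d+d*e m d n e m/d≡n/e = <⇒≤ (begin-strict
  m * e                        <⟨ *-monoˡ-< e (m<[1+m/n]*n m d) ⟩
  suc (m / d) * d * e          ≡⟨ regroup (m / d) d e ⟩
  m / d * e * d + d * e        ≡⟨ cong (λ b → b * e * d + d * e) m/d≡n/e ⟩
  n / e * e * d + d * e        ≤⟨ +-monoˡ-≤ (d * e) (*-monoˡ-≤ d (m/n*n≤m n e)) ⟩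
  n * d + d * e                ∎)
  where
  open ≤-Reasoning
  regroup : ∀ b d e → suc b * d * e ≡ b * e * d + d * e
  regroup = solve-∀

∣m-n∣≤o : ∀ {m n o} → m ≤ n + o → n ≤ m + o → ∣ m - n ∣ ≤ o
∣m-n∣≤o {m} {n} m≤n+o n≤m+o with ∣m-n∣≡[m∸n]∨[n∸m] m n
... | inj₁ eq rewrite eq = m≤n+o⇒m∸n≤o m n m≤n+o
... | inj₂ eq rewrite eq = m≤n+o⇒m∸n≤o n m n≤m+o

m/d≡n/e⇒∣m*e-n*d∣≤d*e : ∀ m d n e .{{_ : NonZero d}} .{{_ : NonZero e}} →
  m / d ≡ n / e → ∣ m * e - n * d ∣ ≤ d * e
m/d≡n/e⇒∣m*e-n*d∣≤d*e m d n e m/d≡n/e = ∣m-n∣≤o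
  (m/d≡n/e⇒m*e≤n*d+d*e m d n e m/d≡n/e)
  (subst (n * d ≤_) (cong (m * e +_) (*-comm e d)) (m/d≡n/e⇒m*e≤n*d+d*e n e m d (sym m/d≡n/e)))

∣m⊖n∣≡∣m-n∣ : ∀ m n → ℤ.∣ m ℤ.⊖ n ∣ ≡ ∣ m - n ∣
∣m⊖n∣≡∣m-n∣ m n with ≤-total m n
... | inj₁ m≤n = trans (ℤ.∣⊖∣-≤ m≤n) (sym (m≤n⇒∣m-n∣≡n∸m m≤n))
... | inj₂ n≤m = trans (ℤ.∣m⊖n∣≡∣n⊖m∣ m n) (trans (ℤ.∣⊖∣-≤ n≤m) (sym (m≤n⇒∣n-m∣≡n∸m n≤m)))

∣a/d-b/e∣≤1/y⇔∣a*e-b*d∣*y≤d*e : ∀ a d b e y .{{_ : NonZero d}} .{{_ : NonZero e}} .{{_ : NonZero y}} →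
  (ℚ.∣ (ℤ.+ a) ℚ./ d ℚ.- (ℤ.+ b) ℚ./ e ∣ ℚ.≤ (ℤ.+ 1) ℚ./ y) ⇔ (∣ a * e - b * d ∣ * y ≤ d * e)
∣a/d-b/e∣≤1/y⇔∣a*e-b*d∣*y≤d*e a d@(suc d′) b e@(suc e′) y@(suc y′) = mk⇔
  (λ h → cross-multiply (ℚᵘ.≤-respʳ-≃ (ℚ.toℚᵘ-fromℚᵘ r) (ℚᵘ.≤-respˡ-≃ dist≃ (ℚ.toℚᵘ-mono-≤ h))))
  (λ h → ℚ.toℚᵘ-cancel-≤ (ℚᵘ.≤-respʳ-≃ (ℚᵘ.≃-sym (ℚ.toℚᵘ-fromℚᵘ r))
                           (ℚᵘ.≤-respˡ-≃ (ℚᵘ.≃-sym dist≃) (*≤* (subst₂ ℤ._≤_ (sym lhs) (sym rhs) (ℤ.+≤+ h))))))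
  where
  p q r : ℚᵘ
  p = mkℚᵘ (ℤ.+ a) d′
  q = mkℚᵘ (ℤ.+ b) e′
  r = mkℚᵘ (ℤ.+ 1) y′
  dist≃ : ℚ.toℚᵘ (ℚ.∣ (ℤ.+ a) ℚ./ d ℚ.- (ℤ.+ b) ℚ./ e ∣) ℚᵘ.≃ ℚᵘ.∣ p ℚᵘ.- q ∣
  dist≃ = ℚᵘ.≃-trans (ℚ.toℚᵘ-homo-∣-∣ (a/d ℚ.- b/e))
    (ℚᵘ.∣-∣-cong (ℚᵘ.≃-trans (ℚ.toℚᵘ-homo-+ a/d (ℚ.- b/e))
      (ℚᵘ.+-cong (ℚ.toℚᵘ-fromℚᵘ p) (ℚᵘ.≃-trans (ℚ.toℚᵘ-homo‿- b/e) (ℚᵘ.-‿cong (ℚ.toℚᵘ-fromℚᵘ q))))))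
    where
    a/d = (ℤ.+ a) ℚ./ d
    b/e = (ℤ.+ b) ℚ./ e
  ↥[p-q]≡a*e⊖b*d : ↥ (p ℚᵘ.- q) ≡ (a * e) ℤ.⊖ (b * d)
  ↥[p-q]≡a*e⊖b*d = trans (cong₂ ℤ._+_ (sym (ℤ.pos-* a e))
      (trans (sym (ℤ.neg-distribˡ-* (ℤ.+ b) (ℤ.+ d))) (cong ℤ.-_ (sym (ℤ.pos-* b d)))))
    (ℤ.m-n≡m⊖n (a * e) (b * d))
  lhs : ↥ ℚᵘ.∣ p ℚᵘ.- q ∣ ℤ.* ↧ r ≡ ℤ.+ (∣ a * e - b * d ∣ * y)
  lhs = trans (cong (λ z → ℤ.+ ℤ.∣ z ∣ ℤ.* ℤ.+ y) ↥[p-q]≡a*e⊖b*d)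
        (trans (sym (ℤ.pos-* (ℤ.∣ (a * e) ℤ.⊖ (b * d) ∣) y))
               (cong (λ z → ℤ.+ (z * y)) (∣m⊖n∣≡∣m-n∣ (a * e) (b * d))))
  rhs : ↥ r ℤ.* ↧ ℚᵘ.∣ p ℚᵘ.- q ∣ ≡ ℤ.+ (d * e)
  rhs = ℤ.*-identityˡ _
  cross-multiply : ℚᵘ.∣ p ℚᵘ.- q ∣ ℚᵘ.≤ r → ∣ a * e - b * d ∣ * y ≤ d * e
  cross-multiply (*≤* h) = ℤ.drop‿+≤+ (subst₂ ℤ._≤_ lhs rhs h)

-- Dyadic boxes and bins

Pair : Set
Pair = ℕ × ℕ

boxes : ℕ → ℕ → List Pair
boxes U N = concatMap (λ u → map (u ,_) (dyadic N)) (dyadic U)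

boxes-positive : ∀ U {N} → 0 < N → All (λ p → 0 < proj₂ p) (boxes U N)
boxes-positive U {N} N>0 =
  concat⁺ (map⁺ (All.universal (λ u → map⁺ (map⁺ (All.universal (λ i → ≤-trans N>0 (m≤m+n N i)) _)))
                               (dyadic U)))

Near : ℕ → ℕ → Pair → Pair → Set
Near k Y (u₁ , n₁) (u₂ , n₂) = ℚ.∣ frac u₁ n₁ k ℚ.- frac u₂ n₂ k ∣ ℚ.≤ inv Y

near? : ∀ k Y p q → Dec (Near k Y p q)
near? k Y (u₁ , n₁) (u₂ , n₂) = ℚ.∣ frac u₁ n₁ k ℚ.- frac u₂ n₂ k ∣ ℚ.≤? inv Y

-- The value at n = 0 is junk; boxes only contain n ≥ N ≥ 1.
bin : ℕ → ℕ → Pair → ℕ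
bin k Y (u , zero)  = 0
bin k Y (u , suc m) = _/_ (u * Y) (suc m ^ k) {{m^n≢0 (suc m) k}}

module _ (k u₁ m₁ u₂ m₂ : ℕ) where
  private
    p q : Pair
    p = (u₁ , suc m₁)
    q = (u₂ , suc m₂)
    D₁ D₂ : ℕ
    D₁ = suc m₁ ^ k
    D₂ = suc m₂ ^ k
    instance
      _ = m^n≢0 (suc m₁) k
      _ = m^n≢0 (suc m₂) k

  near⇔ : ∀ Y .{{_ : NonZero Y}} → Near k Y p q ⇔ (∣ u₁ * Y * D₂ - u₂ * Y * D₁ ∣ ≤ D₁ * D₂)
  near⇔ Y@(suc _) = subst (λ z → Near k Y p q ⇔ (z ≤ D₁ * D₂)) scale
                          (∣a/d-b/e∣≤1/y⇔∣a*e-b*d∣*y≤d*e u₁ D₁ u₂ D₂ Y)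
    where
    reassoc : ∀ u D Y → u * D * Y ≡ u * Y * D
    reassoc = solve-∀
    scale : ∣ u₁ * D₂ - u₂ * D₁ ∣ * Y ≡ ∣ u₁ * Y * D₂ - u₂ * Y * D₁ ∣
    scale = trans (*-distribʳ-∣-∣ Y (u₁ * D₂) (u₂ * D₁)) (cong₂ ∣_-_∣ (reassoc u₁ D₂ Y) (reassoc u₂ D₁ Y))

  near⇒bins-adjacent : ∀ Y .{{_ : NonZero Y}} → Near k Y p q →
    bin k Y p ≤ suc (bin k Y q) × bin k Y q ≤ suc (bin k Y p)
  near⇒bins-adjacent Y near =
      ∣m*e-n*d∣≤d*e⇒m/d≤1+n/e (u₁ * Y) D₁ (u₂ * Y) D₂ close
    , ∣m*e-n*d∣≤d*e⇒m/d≤1+n/e (u₂ * Y) D₂ (u₁ * Y) D₁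
        (subst₂ _≤_ (∣-∣-comm (u₁ * Y * D₂) (u₂ * Y * D₁)) (*-comm D₁ D₂) close)
    where close = Equivalence.to (near⇔ Y) near

  same-bin⇒near : ∀ Y .{{_ : NonZero Y}} → bin k Y p ≡ bin k Y q → Near k Y p q
  same-bin⇒near Y same = Equivalence.from (near⇔ Y) (m/d≡n/e⇒∣m*e-n*d∣≤d*e (u₁ * Y) D₁ (u₂ * Y) D₂ same)

∑-boxes : ∀ U N (f : Pair → ℕ) → ∑ (boxes U N) f ≡ ∑[ u ∈ dyadic U ] ∑[ n ∈ dyadic N ] f (u , n)
∑-boxes U N f = trans (∑-concatMap _ (dyadic U) f) (∑-cong (dyadic U) (λ u → ∑-map (u ,_) (dyadic N) f))

∑-quads : ∀ U₁ N₁ U₂ N₂ (f : Quad → ℕ) → ∑ (quads U₁ N₁ U₂ N₂) f ≡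
  ∑[ u₁ ∈ dyadic U₁ ] ∑[ n₁ ∈ dyadic N₁ ] ∑[ u₂ ∈ dyadic U₂ ] ∑[ n₂ ∈ dyadic N₂ ] f (u₁ , n₁ , u₂ , n₂)
∑-quads U₁ N₁ U₂ N₂ f =
  trans (∑-concatMap _ (dyadic U₁) f) (∑-cong (dyadic U₁) λ u₁ →
  trans (∑-concatMap _ (dyadic N₁) f) (∑-cong (dyadic N₁) λ n₁ →
  trans (∑-concatMap _ (dyadic U₂) f) (∑-cong (dyadic U₂) λ u₂ →
  ∑-map _ (dyadic N₂) f)))

J≡∑∑𝟙-near : ∀ k U₁ N₁ U₂ N₂ Y →
  J k U₁ N₁ U₂ N₂ Y ≡ ∑[ p ∈ boxes U₁ N₁ ] ∑[ q ∈ boxes U₂ N₂ ] 𝟙 (near? k Y p q)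
J≡∑∑𝟙-near k U₁ N₁ U₂ N₂ Y = begin
  J k U₁ N₁ U₂ N₂ Y
    ≡⟨ length-filter≡∑𝟙 _ (quads U₁ N₁ U₂ N₂) ⟩
  ∑ (quads U₁ N₁ U₂ N₂) _
    ≡⟨ ∑-quads U₁ N₁ U₂ N₂ _ ⟩
  (∑[ u₁ ∈ dyadic U₁ ] ∑[ n₁ ∈ dyadic N₁ ] ∑[ u₂ ∈ dyadic U₂ ] ∑[ n₂ ∈ dyadic N₂ ] 𝟙 (near? k Y (u₁ , n₁) (u₂ , n₂)))
    ≡⟨ ∑-cong (dyadic U₁) (λ u₁ → ∑-cong (dyadic N₁) (λ n₁ → ∑-boxes U₂ N₂ _)) ⟨
  (∑[ u₁ ∈ dyadic U₁ ] ∑[ n₁ ∈ dyadic N₁ ] ∑[ q ∈ boxes U₂ N₂ ] 𝟙 (near? k Y (u₁ , n₁) q))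
    ≡⟨ ∑-boxes U₁ N₁ _ ⟨
  (∑[ p ∈ boxes U₁ N₁ ] ∑[ q ∈ boxes U₂ N₂ ] 𝟙 (near? k Y p q)) ∎
  where open ≡-Reasoning

module _ (k Y : ℕ) .{{_ : NonZero Y}} where
  private
    b : Pair → ℕ
    b = bin k Y

  𝟙-near≤δ+δ+δ : ∀ {p q} → 0 < proj₂ p → 0 < proj₂ q →
    𝟙 (near? k Y p q) ≤ δ (b p) (b q) + δ (b p) (suc (b q)) + δ (suc (b p)) (b q)
  𝟙-near≤δ+δ+δ {u₁ , suc m₁} {u₂ , suc m₂} _ _ = 𝟙-≤ (near? k Y (u₁ , suc m₁) (u₂ , suc m₂)) λ near →
    let (bp≤1+bq , bq≤1+bp) = near⇒bins-adjacent k u₁ m₁ u₂ m₂ Y near in δ-adjacent bp≤1+bq bq≤1+bp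

  δ-bins≤𝟙-near : ∀ {p q} → 0 < proj₂ p → 0 < proj₂ q → δ (b p) (b q) ≤ 𝟙 (near? k Y p q)
  δ-bins≤𝟙-near {u₁ , suc m₁} {u₂ , suc m₂} _ _ =
    𝟙-mono (_ ≟ _) (near? k Y (u₁ , suc m₁) (u₂ , suc m₂)) (same-bin⇒near k u₁ m₁ u₂ m₂ Y)

  J≤coincidences : ∀ U₁ {N₁} U₂ {N₂} → 0 < N₁ → 0 < N₂ →
    let xs = boxes U₁ N₁; ys = boxes U₂ N₂ in
    J k U₁ N₁ U₂ N₂ Y ≤ coincidences xs ys b b + coincidences xs ys b (suc ∘ b) + coincidences xs ys (suc ∘ b) b
  J≤coincidences U₁ {N₁} U₂ {N₂} N₁>0 N₂>0 = begin
    J k U₁ N₁ U₂ N₂ Y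
      ≡⟨ J≡∑∑𝟙-near k U₁ N₁ U₂ N₂ Y ⟩
    (∑[ p ∈ xs ] ∑[ q ∈ ys ] 𝟙 (near? k Y p q))
      ≤⟨ ∑∑-mono-on (boxes-positive U₁ N₁>0) (boxes-positive U₂ N₂>0) 𝟙-near≤δ+δ+δ ⟩
    (∑[ p ∈ xs ] ∑[ q ∈ ys ] (δ (b p) (b q) + δ (b p) (suc (b q)) + δ (suc (b p)) (b q)))
      ≡⟨ trans (∑∑-+ xs ys _ _) (cong (_+ coincidences xs ys (suc ∘ b) b) (∑∑-+ xs ys _ _)) ⟩
    coincidences xs ys b b + coincidences xs ys b (suc ∘ b) + coincidences xs ys (suc ∘ b) b ∎
    where
    open ≤-Reasoning
    xs = boxes U₁ N₁
    ys = boxes U₂ N₂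

  coincidences≤J′ : ∀ U {N} → 0 < N → coincidences (boxes U N) (boxes U N) b b ≤ J′ k U N Y
  coincidences≤J′ U {N} N>0 = ≤-trans
    (∑∑-mono-on (boxes-positive U N>0) (boxes-positive U N>0) δ-bins≤𝟙-near)
    (≤-reflexive (sym (J≡∑∑𝟙-near k U N U N Y)))

lemma3p8 : Σ ℕ λ c → (k U₁ N₁ U₂ N₂ Y : ℕ) → k > 0 → U₁ > 0 → N₁ > 0 → U₂ > 0 → N₂ > 0 → Y > 0 →
    J k U₁ N₁ U₂ N₂ Y * J k U₁ N₁ U₂ N₂ Y ≤ c * (J′ k U₁ N₁ Y * J′ k U₂ N₂ Y)
lemma3p8 = 9 , λ where
  k U₁ N₁ U₂ N₂ Y@(suc _) _ _ N₁>0 _ N₂>0 _ →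
    let open ≤-Reasoning
        b = bin k Y
        xs = boxes U₁ N₁
        ys = boxes U₂ N₂
        X₀ = coincidences xs ys b b
        X₁ = coincidences xs ys b (suc ∘ b)
        X₂ = coincidences xs ys (suc ∘ b) b
        J≤X₀+X₁+X₂ = J≤coincidences k Y U₁ U₂ N₁>0 N₂>0
    in begin
    J k U₁ N₁ U₂ N₂ Y * J k U₁ N₁ U₂ N₂ Y
      ≤⟨ *-mono-≤ J≤X₀+X₁+X₂ J≤X₀+X₁+X₂ ⟩
    (X₀ + X₁ + X₂) * (X₀ + X₁ + X₂)
      -- coincidences ys ys (suc ∘ b) (suc ∘ b) is accepted as coincidences ys ys b b:
      -- 𝟙 is defined through `does`, so δ (suc m) (suc n) reduces to δ m n.
      ≤⟨ [p+q+r]*[p+q+r]≤9*t X₀ X₁ X₂ (coincidences-cauchy-schwarz xs ys b b)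
                             (coincidences-cauchy-schwarz xs ys b (suc ∘ b))
                             (coincidences-cauchy-schwarz xs ys (suc ∘ b) b) ⟩
    9 * (coincidences xs xs b b * coincidences ys ys b b)
      ≤⟨ *-monoʳ-≤ 9 (*-mono-≤ (coincidences≤J′ k Y U₁ N₁>0) (coincidences≤J′ k Y U₂ N₂>0)) ⟩
    9 * (J′ k U₁ N₁ Y * J′ k U₂ N₂ Y) ∎
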